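{- Let $E=\mathbf F_3\times\mathbf F_3$ and, for $i\in\mathbf F_3$, let $A_i=\{(x,y)\in E: y=i\}$ and $B_i=\{(x,y)\in E: x=i\}$. Let $T$ be the sparse paving matroid of rank $5$ on $E$ whose circuit-hyperplanes are exactly the eight sets $A_i\cup B_j$ with $(i,j)\in\mathbf F_3\times\mathbf F_3$, $(i,j)\neq(0,0)$ (the tic-tac-toe matroid). Then $T$ does not satisfy the common information property.
   Context: A polymatroid is $(E,f)$ with $E$ finite, $f$ monotone, submodular, $f(\emptyset)=0$; a matroid is a polymatroid with integer-valued $f$ and $f(x)\le1$ for all $x$. A sparse paving matroid of rank $k$ is determined by its family of circuit-hyperplanes, a family of $k$-subsets any two of which meet in at most $k-2$ elements: a $k$-set is a basis iff it is not a circuit-hyperplane. Notation: $f(X\mid Z)=f(X\cup Z)-f(Z)$, $f(X:Y\mid Z)=f(X\cup Z)+f(Y\cup Z)-f(X\cup Y\cup Z)-f(Z)$. An extension of $(E,f)$ is a polymatroid $(E\cup Z,g)$, $E\cap Z=\emptyset$, with $g|_{\mathcal P(E)}=f$. A common information (CI) extension for $(X,Y)$, $X,Y\subseteq E$, is an extension with $g(Z\mid X)=g(Z\mid Y)=0$ and $g(X:Y\mid Z)=0$. Every polymatroid is $0$-CI; for $k\ge1$ a polymatroid is $k$-CI if for every pair of subsets of its ground set it admits a CI extension that is $(k-1)$-CI; it satisfies the common information property if it is $k$-CI for every positive integer $k$. -}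

module Defs where

open import Level using (Level; _⊔_) renaming (suc to lsuc)
open import Data.Nat as ℕ using (ℕ; zero; suc)
open import Data.Bool using (Bool; true; false; _∨_; not)
open import Data.Fin using (Fin; remQuot)
open import Data.Fin.Subset using (Subset; _∪_; _∩_; _⊆_; ∣_∣; ⊥; ⊤)
open import Data.Vec using (Vec; []; _∷_; _++_; tabulate)
open import Data.Vec.Properties using (≡-dec)
open import Data.List using (List; []; _∷_; map; concatMap; filter; foldr)
open import Data.List.Membership.DecPropositional using ()
open import Data.Product using (Σ; _×_; _,_; proj₁; proj₂)
open import Data.Unit.Polymorphic using () renaming (⊤ to ⊤ℓ)
open import Relation.Binary using (Rel; IsTotalOrder)
open import Relation.Binary.PropositionalEquality using (_≡_)
open import Relation.Nullary using (¬_; Dec; yes; no)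
open import Relation.Nullary.Decidable using (⌊_⌋; ¬?; _×-dec_)
open import Algebra.Bundles using (CommutativeRing)
import Data.Fin.Properties as FinP
import Data.Bool.Properties as BoolP

-- Values of polymatroid rank functions: a nontrivial totally ordered
-- commutative ring (the reals are an instance).

record OrderedCommRing (c ℓ₁ ℓ₂ : Level) : Set (lsuc (c ⊔ ℓ₁ ⊔ ℓ₂)) where
  field
    commutativeRing : CommutativeRing c ℓ₁
  open CommutativeRing commutativeRing public
  field
    _≤_          : Rel Carrier ℓ₂
    isTotalOrder : IsTotalOrder _≈_ _≤_
    +-mono-≤     : ∀ {x y} z → x ≤ y → (x + z) ≤ (y + z)
    *-nonneg     : ∀ {x y} → 0# ≤ x → 0# ≤ y → 0# ≤ (x * y)
    0≉1          : ¬ (0# ≈ 1#)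

  fromℕ : ℕ → Carrier
  fromℕ zero    = 0#
  fromℕ (suc n) = 1# + fromℕ n

module Poly {c ℓ₁ ℓ₂} (R : OrderedCommRing c ℓ₁ ℓ₂) where
  open OrderedCommRing R

  record IsPolymatroid {n : ℕ} (f : Subset n → Carrier) : Set (c ⊔ ℓ₁ ⊔ ℓ₂) where
    field
      normalized : f ⊥ ≈ 0#
      monotone   : ∀ X Y → X ⊆ Y → f X ≤ f Y
      submodular : ∀ X Y → (f (X ∪ Y) + f (X ∩ Y)) ≤ (f X + f Y)

  -- E = Fin n embedded as the first n points of Fin (n + m);
  -- the new points Z are the last m points.
  lift : ∀ {n} m → Subset n → Subset (n ℕ.+ m)
  lift m X = X ++ ⊥

  newPts : ∀ n m → Subset (n ℕ.+ m)
  newPts n m = ⊥ {n} ++ ⊤ {m}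

  IsExtension : ∀ {n} m → (Subset n → Carrier) → (Subset (n ℕ.+ m) → Carrier) → Set (c ⊔ ℓ₁ ⊔ ℓ₂)
  IsExtension m f g = IsPolymatroid g × (∀ X → g (lift m X) ≈ f X)

  -- common information conditions for (X , Y) with respect to Z:
  -- g(Z|X) = 0, g(Z|Y) = 0, g(X:Y|Z) = 0
  IsCIFor : ∀ {n} m → (Subset (n ℕ.+ m) → Carrier) → Subset n → Subset n → Set ℓ₁
  IsCIFor {n} m g X Y =
    (g (Z ∪ X′) ≈ g X′) ×
    (g (Z ∪ Y′) ≈ g Y′) ×
    ((g (X′ ∪ Z) + g (Y′ ∪ Z)) ≈ (g ((X′ ∪ Y′) ∪ Z) + g Z))
    where
      Z  = newPts n m
      X′ = lift m X
      Y′ = lift m Y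

  IsKCI : ℕ → (n : ℕ) → (Subset n → Carrier) → Set (c ⊔ ℓ₁ ⊔ ℓ₂)
  IsKCI zero    n f = ⊤ℓ
  IsKCI (suc k) n f =
    ∀ (X Y : Subset n) → Σ ℕ λ m → Σ (Subset (n ℕ.+ m) → Carrier) λ g →
      IsExtension m f g × IsCIFor m g X Y × IsKCI k (n ℕ.+ m) g

  HasCIProperty : (n : ℕ) → (Subset n → Carrier) → Set (c ⊔ ℓ₁ ⊔ ℓ₂)
  HasCIProperty n f = ∀ k → IsKCI k n f

-- The tic-tac-toe matroid on E = F₃ × F₃, encoded as Fin 9 = Fin (3 * 3)
-- via remQuot : Fin (3 * 3) → Fin 3 × Fin 3, p ↦ (x , y).

xc : Fin 9 → Fin 3
xc p = proj₁ (remQuot {3} 3 p)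

yc : Fin 9 → Fin 3
yc p = proj₂ (remQuot {3} 3 p)

AB : Fin 3 → Fin 3 → Subset 9
AB i j = tabulate λ p → ⌊ yc p FinP.≟ i ⌋ ∨ ⌊ xc p FinP.≟ j ⌋

allPairs : List (Fin 3 × Fin 3)
allPairs = concatMap (λ i → map (i ,_) (Data.List.allFin 3)) (Data.List.allFin 3)

circuitHyperplanes : List (Subset 9)
circuitHyperplanes =
  map (λ ij → AB (proj₁ ij) (proj₂ ij))
      (filter (λ ij → ¬? ((proj₁ ij FinP.≟ Fin.zero {2}) ×-dec (proj₂ ij FinP.≟ Fin.zero {2}))) allPairs)

allSubsets : (n : ℕ) → List (Subset n)
allSubsets zero    = [] ∷ []
allSubsets (suc n) = concatMap (λ X → (false ∷ X) ∷ (true ∷ X) ∷ []) (allSubsets n)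

open Data.List.Membership.DecPropositional (≡-dec {n = 9} BoolP._≟_) using (_∈?_)

-- sparse paving matroid of rank 5: bases are the 5-subsets that are not
-- circuit-hyperplanes
bases : List (Subset 9)
bases = filter (λ B → (∣ B ∣ ℕ.≟ 5) ×-dec ¬? (B ∈? circuitHyperplanes)) (allSubsets 9)

tttRank : Subset 9 → ℕ
tttRank X = foldr (λ B r → ∣ X ∩ B ∣ ℕ.⊔ r) 0 bases

tictactoe : ∀ {c ℓ₁ ℓ₂} (R : OrderedCommRing c ℓ₁ ℓ₂) → Subset 9 → OrderedCommRing.Carrier R
tictactoe R X = OrderedCommRing.fromℕ R (tttRank X)

-- Take a common information z of (A₁, A₂) and then, one extension further, a
-- common information w of (A₀, A₁); let h be the resulting extension of T.
-- Each of z, w has rank at least the mutual information of its pair,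
-- r(Aᵢ) + r(Aᵢ′) − r(Aᵢ ∪ Aᵢ′) = 1.  For every column B_j, the sets B_j ∪ A₁ and
-- B_j ∪ A₂ are circuit-hyperplanes forming a modular pair with meet B_j, so z is
-- a function of every column; likewise w is a function of B₁ and B₂.  Hence
-- h(z ∪ w) ≤ r(B₁) + r(B₂) − r(B₁ ∪ B₂) = 1.  On the other hand, z being a
-- function of B₁ and of B₀ makes it independent of the corner A₀ ∩ B₀ and then
-- of A₀ (both are modular pairs), while conditioning on A₀ is finer than
-- conditioning on w, its function:
--   1 ≤ h(z) ≤ h(z | A₀ ∩ B₀) ≤ h(z | A₀) ≤ h(z | w) = h(z ∪ w) − h(w) ≤ 1 − 1.

{-# OPTIONS --safe #-}
module Submission where

open import Defs
open import Data.Nat as ℕ using (ℕ; zero; suc)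
open import Data.Bool using (_∨_; _∧_)
open import Data.Vec using (_∷_; _++_; replicate; zipWith; tabulate)
open import Data.Fin using (Fin; #_; zero; suc)
open import Data.Fin.Properties using (_≟_)
open import Relation.Nullary.Decidable using (⌊_⌋)
open import Data.Vec.Properties using (zipWith-++; zipWith-replicate)
open import Function using (_∘_)
open import Data.Fin.Subset using (Subset; _∪_; _∩_; _⊆_; ⊥; outside; inside)
open import Data.Fin.Subset.Properties
  using ( ⊆-refl; ⊆-trans; ⊆-antisym; p⊆p∪q; q⊆p∪q; x∈p∪q⁻; x∈p∩q⁺
        ; ∪-assoc; ∪-comm; ∪-distribʳ-∩)
open import Data.Product using (_×_; _,_; proj₁; proj₂)
open import Data.Sum using ([_,_]′)
open import Relation.Binary.PropositionalEquality as ≡ using (_≡_)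
open import Relation.Nullary using (¬_)
import Data.Empty as Empty
open import Relation.Binary.Bundles using (Poset)
open import Relation.Binary.Structures using (IsTotalOrder)
import Relation.Binary.Reasoning.PartialOrder as PosetReasoning
import Algebra.Properties.AbelianGroup as AbelianGroupProperties
import Algebra.Properties.Ring as RingProperties
import Algebra.Solver.CommutativeMonoid as CommutativeMonoidSolver

module OrderedCommRingProperties {c ℓ₁ ℓ₂} (R : OrderedCommRing c ℓ₁ ℓ₂) where
  open OrderedCommRing R public hiding (_≤_)
  open OrderedCommRing R public using () renaming (_≤_ to infix 4 _≤_)
  open AbelianGroupProperties +-abelianGroup using (⁻¹-∙-comm; ⁻¹-involutive)
  open RingProperties ring using (-‿distribˡ-*)
  open CommutativeMonoidSolver +-commutativeMonoid using (solve; _⊜_; _⊕_)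

  poset : Poset c ℓ₁ ℓ₂
  poset = record { isPartialOrder = IsTotalOrder.isPartialOrder isTotalOrder }

  open Poset poset public using (antisym)
    renaming (reflexive to ≤-reflexive; trans to ≤-trans)
  open PosetReasoning poset public

  +-monoʳ-≤ : ∀ z {x y} → x ≤ y → z + x ≤ z + y
  +-monoʳ-≤ z {x} {y} x≤y = begin
    z + x  ≈⟨ +-comm z x ⟩
    x + z  ≤⟨ +-mono-≤ z x≤y ⟩
    y + z  ≈⟨ +-comm y z ⟩
    z + y  ∎

  +-mono₂-≤ : ∀ {x y u v} → x ≤ y → u ≤ v → x + u ≤ y + v
  +-mono₂-≤ {y = y} {u} x≤y u≤v = ≤-trans (+-mono-≤ u x≤y) (+-monoʳ-≤ y u≤v)

  [x+y]-x≈y : ∀ x y → (x + y) - x ≈ y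
  [x+y]-x≈y x y = begin-equality
    (x + y) + - x    ≈⟨ solve 3 (λ x y x′ → (x ⊕ y) ⊕ x′ ⊜ y ⊕ (x ⊕ x′))
                              refl x y (- x) ⟩
    y + (x + - x)    ≈⟨ +-congˡ (-‿inverseʳ x) ⟩
    y + 0#           ≈⟨ +-identityʳ y ⟩
    y                ∎

  [x+y]-[x+z]≈y-z : ∀ x y z → (x + y) - (x + z) ≈ y - z
  [x+y]-[x+z]≈y-z x y z = begin-equality
    (x + y) + - (x + z)    ≈⟨ +-congˡ (⁻¹-∙-comm x z) ⟨
    (x + y) + (- x + - z)  ≈⟨ solve 4 (λ x y x′ z′ →
                                          (x ⊕ y) ⊕ (x′ ⊕ z′) ⊜ (x ⊕ x′) ⊕ (y ⊕ z′))
                                refl x y (- x) (- z) ⟩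
    (x + - x) + (y - z)    ≈⟨ +-congʳ (-‿inverseʳ x) ⟩
    0# + (y - z)           ≈⟨ +-identityˡ (y - z) ⟩
    y - z                  ∎

  [x-z]-[y-z]≈x-y : ∀ x y z → (x - z) - (y - z) ≈ x - y
  [x-z]-[y-z]≈x-y x y z = begin-equality
    (x + - z) + - (y + - z)    ≈⟨ +-congˡ (⁻¹-∙-comm y (- z)) ⟨
    (x + - z) + (- y + - - z)  ≈⟨ +-congˡ (+-congˡ (⁻¹-involutive z)) ⟩
    (x + - z) + (- y + z)      ≈⟨ solve 4 (λ x y′ z z′ →
                                              (x ⊕ z′) ⊕ (y′ ⊕ z) ⊜ (x ⊕ y′) ⊕ (z ⊕ z′))
                                    refl x (- y) z (- z) ⟩
    (x - y) + (z + - z)        ≈⟨ +-congˡ (-‿inverseʳ z) ⟩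
    (x - y) + 0#               ≈⟨ +-identityʳ (x - y) ⟩
    x - y                      ∎

  [x-u]+[y-v]+[[u+v]-w]≈[x+y]-w : ∀ x y u v w →
    ((x - u) + (y - v)) + ((u + v) - w) ≈ (x + y) - w
  [x-u]+[y-v]+[[u+v]-w]≈[x+y]-w x y u v w = begin-equality
    ((x + - u) + (y + - v)) + ((u + v) + - w)
      ≈⟨ solve 7 (λ x y u v u′ v′ w′ →
                    ((x ⊕ u′) ⊕ (y ⊕ v′)) ⊕ ((u ⊕ v) ⊕ w′) ⊜
                    ((x ⊕ y) ⊕ w′) ⊕ ((u ⊕ u′) ⊕ (v ⊕ v′)))
                 refl x y u v (- u) (- v) (- w) ⟩
    ((x + y) - w) + ((u + - u) + (v + - v))
      ≈⟨ +-congˡ (+-cong (-‿inverseʳ u) (-‿inverseʳ v)) ⟩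
    ((x + y) - w) + (0# + 0#)
      ≈⟨ +-congˡ (+-identityˡ 0#) ⟩
    ((x + y) - w) + 0#
      ≈⟨ +-identityʳ _ ⟩
    (x + y) - w
      ∎

  x+y≤z+w⇒x-z≤w-y : ∀ {x y z w} → x + y ≤ z + w → x - z ≤ w - y
  x+y≤z+w⇒x-z≤w-y {x} {y} {z} {w} le = begin
    x - z              ≈⟨ [x+y]-[x+z]≈y-z y x z ⟨
    (y + x) - (y + z)  ≈⟨ +-cong (+-comm y x) (-‿cong (+-comm y z)) ⟩
    (x + y) - (z + y)  ≤⟨ +-mono-≤ (- (z + y)) le ⟩
    (z + w) - (z + y)  ≈⟨ [x+y]-[x+z]≈y-z z w y ⟩
    w - y              ∎

  +-cancelˡ-≤ : ∀ z {x y} → z + x ≤ z + y → x ≤ y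
  +-cancelˡ-≤ z {x} {y} le = begin
    x              ≈⟨ [x+y]-x≈y z x ⟨
    (z + x) - z    ≤⟨ +-mono-≤ (- z) le ⟩
    (z + y) - z    ≈⟨ [x+y]-x≈y z y ⟩
    y              ∎

  -‿antitone : ∀ {x y} → x ≤ y → - y ≤ - x
  -‿antitone {x} {y} x≤y = begin
    - y               ≈⟨ [x+y]-x≈y x (- y) ⟨
    (x + - y) + - x   ≤⟨ +-mono-≤ (- x) (+-mono-≤ (- y) x≤y) ⟩
    (y + - y) + - x   ≈⟨ +-congʳ (-‿inverseʳ y) ⟩
    0# + - x          ≈⟨ +-identityˡ (- x) ⟩
    - x               ∎

  x≤y∧v≤u⇒x-u≤y-v : ∀ {x y u v} → x ≤ y → v ≤ u → x - u ≤ y - v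
  x≤y∧v≤u⇒x-u≤y-v x≤y v≤u = +-mono₂-≤ x≤y (-‿antitone v≤u)

  x≤y⇒x-y≤0 : ∀ {x y} → x ≤ y → x - y ≤ 0#
  x≤y⇒x-y≤0 {x} {y} x≤y = ≤-trans (+-mono-≤ (- y) x≤y) (≤-reflexive (-‿inverseʳ y))

  x-y≤0⇒x≤y : ∀ {x y} → x - y ≤ 0# → x ≤ y
  x-y≤0⇒x≤y {x} {y} le = begin
    x                ≈⟨ [x+y]-x≈y (- y) x ⟨
    (- y + x) - - y  ≈⟨ +-cong (+-comm (- y) x) (⁻¹-involutive y) ⟩
    (x - y) + y      ≤⟨ +-mono-≤ y le ⟩
    0# + y           ≈⟨ +-identityˡ y ⟩
    y                ∎

  1≰0 : ¬ (1# ≤ 0#)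
  1≰0 1≤0 = 0≉1 (antisym 0≤1 1≤0)
    where
    0≤-1 : 0# ≤ - 1#
    0≤-1 = begin
      0#        ≈⟨ -‿inverseʳ 0# ⟨
      0# - 0#   ≈⟨ +-identityˡ (- 0#) ⟩
      - 0#      ≤⟨ -‿antitone 1≤0 ⟩
      - 1#      ∎
    0≤1 : 0# ≤ 1#
    0≤1 = begin
      0#            ≤⟨ *-nonneg 0≤-1 0≤-1 ⟩
      - 1# * - 1#   ≈⟨ -‿distribˡ-* 1# (- 1#) ⟨
      - (1# * - 1#) ≈⟨ -‿cong (*-identityˡ (- 1#)) ⟩
      - - 1#        ≈⟨ ⁻¹-involutive 1# ⟩
      1#            ∎

  fromℕ-+ : ∀ m n → fromℕ (m ℕ.+ n) ≈ fromℕ m + fromℕ n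
  fromℕ-+ zero    n = sym (+-identityˡ (fromℕ n))
  fromℕ-+ (suc m) n = trans (+-congˡ (fromℕ-+ m n)) (sym (+-assoc 1# (fromℕ m) (fromℕ n)))

module _ {n : ℕ} where

  ∪-least : {X Y Z : Subset n} → X ⊆ Z → Y ⊆ Z → X ∪ Y ⊆ Z
  ∪-least {X} {Y} X⊆Z Y⊆Z x∈X∪Y = [ X⊆Z , Y⊆Z ]′ (x∈p∪q⁻ X Y x∈X∪Y)

  ∩-greatest : {W X Y : Subset n} → W ⊆ X → W ⊆ Y → W ⊆ X ∩ Y
  ∩-greatest W⊆X W⊆Y x∈W = x∈p∩q⁺ (W⊆X x∈W , W⊆Y x∈W)

  ∪-mono-⊆ : {X X′ Y Y′ : Subset n} → X ⊆ X′ → Y ⊆ Y′ → X ∪ Y ⊆ X′ ∪ Y′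
  ∪-mono-⊆ {X′ = X′} {Y′ = Y′} X⊆X′ Y⊆Y′ =
    ∪-least (⊆-trans X⊆X′ (p⊆p∪q Y′)) (⊆-trans Y⊆Y′ (q⊆p∪q X′ Y′))

  ⊆⇒∪≡ : {X Y : Subset n} → X ⊆ Y → X ∪ Y ≡ Y
  ⊆⇒∪≡ {X} {Y} X⊆Y = ⊆-antisym (∪-least X⊆Y ⊆-refl) (q⊆p∪q X Y)

record IsSubsetHom {k n : ℕ} (φ : Subset k → Subset n) : Set where
  field
    ∪-homo : ∀ X Y → φ (X ∪ Y) ≡ φ X ∪ φ Y
    ∩-homo : ∀ X Y → φ (X ∩ Y) ≡ φ X ∩ φ Y
    ⊥-homo : φ ⊥ ≡ ⊥

∘-isSubsetHom : ∀ {j k n} {φ : Subset k → Subset n} {ψ : Subset j → Subset k} →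
                IsSubsetHom φ → IsSubsetHom ψ → IsSubsetHom (φ ∘ ψ)
∘-isSubsetHom {φ = φ} {ψ} φ-hom ψ-hom = record
  { ∪-homo = λ X Y → ≡.trans (≡.cong φ (ψ.∪-homo X Y)) (φ.∪-homo (ψ X) (ψ Y))
  ; ∩-homo = λ X Y → ≡.trans (≡.cong φ (ψ.∩-homo X Y)) (φ.∩-homo (ψ X) (ψ Y))
  ; ⊥-homo = ≡.trans (≡.cong φ ψ.⊥-homo) φ.⊥-homo
  }
  where
  module φ = IsSubsetHom φ-hom
  module ψ = IsSubsetHom ψ-hom

-- The head point of Subset (suc n) becomes the m new points of Subset (n + m).
attach : ∀ {n} m → Subset (suc n) → Subset (n ℕ.+ m)
attach m (b ∷ X) = X ++ replicate m b

⊥++⊥ : ∀ n m → ⊥ {n} ++ ⊥ {m} ≡ ⊥ {n ℕ.+ m}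
⊥++⊥ zero    m = ≡.refl
⊥++⊥ (suc n) m = ≡.cong (outside ∷_) (⊥++⊥ n m)

attach-isSubsetHom : ∀ {n} m → IsSubsetHom (attach {n} m)
attach-isSubsetHom {n} m = record
  { ∪-homo = λ { (b ∷ X) (c ∷ Y) → zipWith-attach _∨_ b c X Y }
  ; ∩-homo = λ { (b ∷ X) (c ∷ Y) → zipWith-attach _∧_ b c X Y }
  ; ⊥-homo = ⊥++⊥ n m
  }
  where
  zipWith-attach : ∀ _⊕_ b c (X Y : Subset n) →
                   zipWith _⊕_ X Y ++ replicate m (b ⊕ c) ≡
                   zipWith _⊕_ (X ++ replicate m b) (Y ++ replicate m c)
  zipWith-attach _⊕_ b c X Y = ≡.sym (≡.trans
    (zipWith-++ _⊕_ X (replicate m b) Y (replicate m c))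
    (≡.cong (zipWith _⊕_ X Y ++_) (zipWith-replicate _⊕_ b c)))

keepHead : ∀ {k n} → (Subset k → Subset n) → Subset (suc k) → Subset (suc n)
keepHead φ (b ∷ X) = b ∷ φ X

keepHead-isSubsetHom : ∀ {k n} {φ : Subset k → Subset n} →
                       IsSubsetHom φ → IsSubsetHom (keepHead φ)
keepHead-isSubsetHom φ-hom = record
  { ∪-homo = λ { (b ∷ X) (c ∷ Y) → ≡.cong ((b ∨ c) ∷_) (∪-homo X Y) }
  ; ∩-homo = λ { (b ∷ X) (c ∷ Y) → ≡.cong ((b ∧ c) ∷_) (∩-homo X Y) }
  ; ⊥-homo = ≡.cong (outside ∷_) ⊥-homo
  }
  where open IsSubsetHom φ-hom

module Information {c ℓ₁ ℓ₂} (R : OrderedCommRing c ℓ₁ ℓ₂) where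
  open OrderedCommRingProperties R
  open Poly R using (IsPolymatroid)

  module _ {n : ℕ} (f : Subset n → Carrier) where

    infix 9 _[_∣_] _[_∶_]

    _[_∣_] : Subset n → Subset n → Carrier
    _[_∣_] Z X = f (X ∪ Z) - f X

    _[_∶_] : Subset n → Subset n → Carrier
    _[_∶_] X Y = (f X + f Y) - (f (X ∪ Y) + f (X ∩ Y))

    Determines : Subset n → Subset n → Set ℓ₂
    Determines X Z = f (X ∪ Z) ≤ f X

    -- A product rather than a record, so that Poly.IsCIFor m g X Y is literally
    -- IsCommonInformation g (newPts n m) (lift m X) (lift m Y).
    IsCommonInformation : Subset n → Subset n → Subset n → Set ℓ₁
    IsCommonInformation Z X Y =
      (f (Z ∪ X) ≈ f X) × (f (Z ∪ Y) ≈ f Y) ×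
      (f (X ∪ Z) + f (Y ∪ Z) ≈ f ((X ∪ Y) ∪ Z) + f Z)

  module _ {n : ℕ} {f : Subset n → Carrier} (poly : IsPolymatroid f) where
    open IsPolymatroid poly

    submodular-over : ∀ X Y Z → f (X ∪ Y) + f ((X ∩ Y) ∪ Z) ≤ f (X ∪ Z) + f (Y ∪ Z)
    submodular-over X Y Z = begin
      f (X ∪ Y) + f ((X ∩ Y) ∪ Z)
        ≤⟨ +-mono-≤ _ (monotone _ _ (∪-mono-⊆ (p⊆p∪q Z) (p⊆p∪q Z))) ⟩
      f ((X ∪ Z) ∪ (Y ∪ Z)) + f ((X ∩ Y) ∪ Z)
        ≡⟨ ≡.cong (λ S → f ((X ∪ Z) ∪ (Y ∪ Z)) + f S) (∪-distribʳ-∩ Z X Y) ⟩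
      f ((X ∪ Z) ∪ (Y ∪ Z)) + f ((X ∪ Z) ∩ (Y ∪ Z))
        ≤⟨ submodular (X ∪ Z) (Y ∪ Z) ⟩
      f (X ∪ Z) + f (Y ∪ Z)
        ∎

    cond-antitone : ∀ {X W Z} → Determines f X W → f [ Z ∣ X ] ≤ f [ Z ∣ W ]
    cond-antitone {X} {W} {Z} X→W = x+y≤z+w⇒x-z≤w-y (begin
      f (X ∪ Z) + f W
        ≤⟨ +-mono₂-≤ (monotone _ _ (∪-mono-⊆ (p⊆p∪q W) (q⊆p∪q W Z)))
                     (monotone _ _ (∩-greatest (q⊆p∪q X W) (p⊆p∪q Z))) ⟩
      f ((X ∪ W) ∪ (W ∪ Z)) + f ((X ∪ W) ∩ (W ∪ Z))
        ≤⟨ submodular (X ∪ W) (W ∪ Z) ⟩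
      f (X ∪ W) + f (W ∪ Z)
        ≤⟨ +-mono-≤ _ X→W ⟩
      f X + f (W ∪ Z)
        ∎)

    determines-⊆ : ∀ {X Y Z} → X ⊆ Y → Determines f X Z → Determines f Y Z
    determines-⊆ {X} {Y} {Z} X⊆Y X→Z = x-y≤0⇒x≤y (begin
      f [ Z ∣ Y ]  ≤⟨ cond-antitone (monotone _ _ (∪-least ⊆-refl X⊆Y)) ⟩
      f [ Z ∣ X ]  ≤⟨ x≤y⇒x-y≤0 X→Z ⟩
      0#           ∎)

    determines-∪ : ∀ {X Z W} → Determines f X Z → Determines f X W → Determines f X (Z ∪ W)
    determines-∪ {X} {Z} {W} X→Z X→W = +-cancelˡ-≤ (f X) (begin
      f X + f (X ∪ (Z ∪ W))
        ≈⟨ +-comm _ _ ⟩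
      f (X ∪ (Z ∪ W)) + f X
        ≤⟨ +-mono₂-≤ (monotone _ _ (∪-least (⊆-trans (p⊆p∪q Z) (p⊆p∪q (X ∪ W)))
                                            (∪-mono-⊆ (q⊆p∪q X Z) (q⊆p∪q X W))))
                     (monotone _ _ (∩-greatest (p⊆p∪q Z) (p⊆p∪q W))) ⟩
      f ((X ∪ Z) ∪ (X ∪ W)) + f ((X ∪ Z) ∩ (X ∪ W))
        ≤⟨ submodular (X ∪ Z) (X ∪ W) ⟩
      f (X ∪ Z) + f (X ∪ W)
        ≤⟨ +-mono₂-≤ X→Z X→W ⟩
      f X + f X
        ∎)

    cond-∩-≤ : ∀ X Y Z → f [ Z ∣ X ∩ Y ] ≤ (f [ Z ∣ X ] + f [ Z ∣ Y ]) + f [ X ∶ Y ]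
    cond-∩-≤ X Y Z = begin
      f ((X ∩ Y) ∪ Z) - f (X ∩ Y)
        ≈⟨ [x+y]-[x+z]≈y-z (f (X ∪ Y)) _ _ ⟨
      (f (X ∪ Y) + f ((X ∩ Y) ∪ Z)) - (f (X ∪ Y) + f (X ∩ Y))
        ≤⟨ +-mono-≤ _ (submodular-over X Y Z) ⟩
      (f (X ∪ Z) + f (Y ∪ Z)) - (f (X ∪ Y) + f (X ∩ Y))
        ≈⟨ [x-u]+[y-v]+[[u+v]-w]≈[x+y]-w _ _ _ _ _ ⟨
      (f [ Z ∣ X ] + f [ Z ∣ Y ]) + f [ X ∶ Y ]
        ∎

    cond-∩≤mutual : ∀ {X Y Z} → Determines f X Z → Determines f Y Z →
                    f [ Z ∣ X ∩ Y ] ≤ f [ X ∶ Y ]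
    cond-∩≤mutual {X} {Y} {Z} X→Z Y→Z = begin
      f [ Z ∣ X ∩ Y ]
        ≤⟨ cond-∩-≤ X Y Z ⟩
      (f [ Z ∣ X ] + f [ Z ∣ Y ]) + f [ X ∶ Y ]
        ≤⟨ +-mono-≤ _ (+-mono₂-≤ (x≤y⇒x-y≤0 X→Z) (x≤y⇒x-y≤0 Y→Z)) ⟩
      (0# + 0#) + f [ X ∶ Y ]
        ≈⟨ trans (+-congʳ (+-identityˡ 0#)) (+-identityˡ _) ⟩
      f [ X ∶ Y ]
        ∎

    cond-∩-modular : ∀ {X Y Z} → Determines f Y Z → f [ X ∶ Y ] ≈ 0# →
                     f [ Z ∣ X ∩ Y ] ≤ f [ Z ∣ X ]
    cond-∩-modular {X} {Y} {Z} Y→Z modular = begin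
      f [ Z ∣ X ∩ Y ]
        ≤⟨ cond-∩-≤ X Y Z ⟩
      (f [ Z ∣ X ] + f [ Z ∣ Y ]) + f [ X ∶ Y ]
        ≤⟨ +-mono₂-≤ (+-monoʳ-≤ _ (x≤y⇒x-y≤0 Y→Z)) (≤-reflexive modular) ⟩
      (f [ Z ∣ X ] + 0#) + 0#
        ≈⟨ trans (+-identityʳ _) (+-identityʳ _) ⟩
      f [ Z ∣ X ]
        ∎

    determines-∩ : ∀ {X Y Z} → f [ X ∶ Y ] ≈ 0# → Determines f X Z → Determines f Y Z →
                   Determines f (X ∩ Y) Z
    determines-∩ modular X→Z Y→Z =
      x-y≤0⇒x≤y (≤-trans (cond-∩≤mutual X→Z Y→Z) (≤-reflexive modular))

    cond-chain : ∀ X W Z → f [ Z ∣ X ∪ W ] ≈ f [ W ∪ Z ∣ X ] - f [ W ∣ X ]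
    cond-chain X W Z = begin-equality
      f ((X ∪ W) ∪ Z) - f (X ∪ W)
        ≡⟨ ≡.cong (λ S → f S - f (X ∪ W)) (∪-assoc X W Z) ⟩
      f (X ∪ (W ∪ Z)) - f (X ∪ W)
        ≈⟨ [x-z]-[y-z]≈x-y _ _ (f X) ⟨
      (f (X ∪ (W ∪ Z)) - f X) - (f (X ∪ W) - f X)
        ∎

    module _ {Z X Y} (ci : IsCommonInformation f Z X Y) where
      private
        Z∪X≈X       = proj₁ ci
        Z∪Y≈Y       = proj₁ (proj₂ ci)
        independent = proj₂ (proj₂ ci)

      commonInformation-determinedˡ : Determines f X Z
      commonInformation-determinedˡ =
        ≡.subst (λ S → f S ≤ f X) (∪-comm Z X) (≤-reflexive Z∪X≈X)

      commonInformation-determinedʳ : Determines f Y Z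
      commonInformation-determinedʳ =
        ≡.subst (λ S → f S ≤ f Y) (∪-comm Z Y) (≤-reflexive Z∪Y≈Y)

      mutual≤common : f [ X ∶ Y ] ≤ f [ Z ∣ X ∩ Y ]
      mutual≤common = begin
        (f X + f Y) - (f (X ∪ Y) + f (X ∩ Y))
          ≤⟨ +-mono-≤ _ (begin
               f X + f Y
                 ≤⟨ +-mono₂-≤ (monotone _ _ (p⊆p∪q Z)) (monotone _ _ (p⊆p∪q Z)) ⟩
               f (X ∪ Z) + f (Y ∪ Z)
                 ≈⟨ independent ⟩
               f ((X ∪ Y) ∪ Z) + f Z
                 ≤⟨ +-mono₂-≤ (determines-⊆ (p⊆p∪q Y) commonInformation-determinedˡ)
                              (monotone _ _ (q⊆p∪q (X ∩ Y) Z)) ⟩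
               f (X ∪ Y) + f ((X ∩ Y) ∪ Z)
                 ∎) ⟩
        (f (X ∪ Y) + f ((X ∩ Y) ∪ Z)) - (f (X ∪ Y) + f (X ∩ Y))
          ≈⟨ [x+y]-[x+z]≈y-z _ _ _ ⟩
        f [ Z ∣ X ∩ Y ]
          ∎

  mutual-fromℕ : ∀ {n} {f : Subset n → Carrier} (r : Subset n → ℕ) →
                 (∀ X → f X ≈ fromℕ (r X)) →
                 ∀ {X Y} k → r X ℕ.+ r Y ≡ (r (X ∪ Y) ℕ.+ r (X ∩ Y)) ℕ.+ k →
                 f [ X ∶ Y ] ≈ fromℕ k
  mutual-fromℕ {f = f} r f≈r {X} {Y} k ranks = begin-equality
    (f X + f Y) - (f (X ∪ Y) + f (X ∩ Y))
      ≈⟨ +-cong (+-cong (f≈r X) (f≈r Y)) (-‿cong (+-cong (f≈r (X ∪ Y)) (f≈r (X ∩ Y)))) ⟩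
    (fromℕ (r X) + fromℕ (r Y)) - (fromℕ (r (X ∪ Y)) + fromℕ (r (X ∩ Y)))
      ≈⟨ +-cong (fromℕ-+ (r X) (r Y)) (-‿cong (fromℕ-+ (r (X ∪ Y)) (r (X ∩ Y)))) ⟨
    fromℕ (r X ℕ.+ r Y) - fromℕ s
      ≡⟨ ≡.cong (λ m → fromℕ m - fromℕ s) ranks ⟩
    fromℕ (s ℕ.+ k) - fromℕ s
      ≈⟨ +-congʳ (fromℕ-+ s k) ⟩
    (fromℕ s + fromℕ k) - fromℕ s
      ≈⟨ [x+y]-x≈y _ _ ⟩
    fromℕ k
      ∎
    where s = r (X ∪ Y) ℕ.+ r (X ∩ Y)

  module _ {k n} {φ : Subset k → Subset n} (φ-hom : IsSubsetHom φ) where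
    open IsSubsetHom φ-hom

    polymatroid-∘ : ∀ {f : Subset n → Carrier} → IsPolymatroid f → IsPolymatroid (f ∘ φ)
    polymatroid-∘ {f} poly = record
      { normalized = trans (reflexive (≡.cong f ⊥-homo)) normalized
      ; monotone   = λ X Y X⊆Y → monotone _ _ (≡.subst (φ X ⊆_) (φ-∪ X⊆Y) (p⊆p∪q (φ Y)))
      ; submodular = λ X Y → ≡.subst₂ (λ U V → f U + f V ≤ f (φ X) + f (φ Y))
                                       (≡.sym (∪-homo X Y)) (≡.sym (∩-homo X Y))
                                       (submodular (φ X) (φ Y))
      }
      where
      open IsPolymatroid poly
      φ-∪ : ∀ {X Y} → X ⊆ Y → φ X ∪ φ Y ≡ φ Y
      φ-∪ {X} {Y} X⊆Y = ≡.trans (≡.sym (∪-homo X Y)) (≡.cong φ (⊆⇒∪≡ X⊆Y))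

    commonInformation-∘ : ∀ {f : Subset n → Carrier} Z X Y →
                          IsCommonInformation f (φ Z) (φ X) (φ Y) →
                          IsCommonInformation (f ∘ φ) Z X Y
    commonInformation-∘ {f} Z X Y (Z∪X≈X , Z∪Y≈Y , independent) =
      trans (f-φ (∪-homo Z X)) Z∪X≈X ,
      trans (f-φ (∪-homo Z Y)) Z∪Y≈Y ,
      (begin-equality
        f (φ (X ∪ Z)) + f (φ (Y ∪ Z))    ≈⟨ +-cong (f-φ (∪-homo X Z)) (f-φ (∪-homo Y Z)) ⟩
        f (φ X ∪ φ Z) + f (φ Y ∪ φ Z)    ≈⟨ independent ⟩
        f ((φ X ∪ φ Y) ∪ φ Z) + f (φ Z)  ≈⟨ +-congʳ (f-φ φ-∪∪) ⟨
        f (φ ((X ∪ Y) ∪ Z)) + f (φ Z)    ∎)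
      where
      f-φ : ∀ {U V} → U ≡ V → f U ≈ f V
      f-φ U≡V = reflexive (≡.cong f U≡V)
      φ-∪∪ : φ ((X ∪ Y) ∪ Z) ≡ (φ X ∪ φ Y) ∪ φ Z
      φ-∪∪ = ≡.trans (∪-homo (X ∪ Y) Z) (≡.cong (_∪ φ Z) (∪-homo X Y))

  commonInformation-resp : ∀ {n} {f g : Subset n → Carrier} {Z X Y} → (∀ S → f S ≈ g S) →
                           IsCommonInformation f Z X Y → IsCommonInformation g Z X Y
  commonInformation-resp f≈g (Z∪X≈X , Z∪Y≈Y , independent) =
    trans (sym (f≈g _)) (trans Z∪X≈X (f≈g _)) ,
    trans (sym (f≈g _)) (trans Z∪Y≈Y (f≈g _)) ,
    trans (sym (+-cong (f≈g _) (f≈g _))) (trans independent (+-cong (f≈g _) (f≈g _)))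

A B : Fin 3 → Subset 9
A i = tabulate λ p → ⌊ yc p ≟ i ⌋
B j = tabulate λ p → ⌊ xc p ≟ j ⌋

E : Subset 9 → Subset 11
E X = outside ∷ outside ∷ X

w z : Subset 11
w = inside ∷ outside ∷ ⊥
z = outside ∷ inside ∷ ⊥

module TicTacToe {c ℓ₁ ℓ₂} (R : OrderedCommRing c ℓ₁ ℓ₂) where
  open OrderedCommRingProperties R
  open Poly R using (IsPolymatroid; IsKCI; lift)
  open Information R

  module _ {h : Subset 11 → Carrier} (poly : IsPolymatroid h)
           (rank : ∀ X → h (E X) ≈ tictactoe R X)
           (z-common : IsCommonInformation h z (E (A (# 1))) (E (A (# 2))))
           (w-common : IsCommonInformation h w (E (A (# 0))) (E (A (# 1)))) where

    mutual-rank : ∀ X Y k →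
                  tttRank X ℕ.+ tttRank Y ≡ (tttRank (X ∪ Y) ℕ.+ tttRank (X ∩ Y)) ℕ.+ k →
                  h [ E X ∶ E Y ] ≈ fromℕ k
    mutual-rank X Y = mutual-fromℕ tttRank rank

    one-bit : ∀ X Y →
              tttRank X ℕ.+ tttRank Y ≡ (tttRank (X ∪ Y) ℕ.+ tttRank (X ∩ Y)) ℕ.+ 1 →
              h [ E X ∶ E Y ] ≈ 1#
    one-bit X Y ranks = trans (mutual-rank X Y 1 ranks) (+-identityʳ 1#)

    determined-by-column : ∀ {Z} i i′ j →
                           Determines h (E (A i)) Z → Determines h (E (A i′)) Z →
                           h [ E (B j ∪ A i) ∶ E (B j ∪ A i′) ] ≈ 0# →
                           Determines h (E ((B j ∪ A i) ∩ (B j ∪ A i′))) Z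
    determined-by-column i i′ j Aᵢ→Z Aᵢ′→Z modular = determines-∩ poly modular
      (determines-⊆ poly (q⊆p∪q (E (B j)) (E (A i))) Aᵢ→Z)
      (determines-⊆ poly (q⊆p∪q (E (B j)) (E (A i′))) Aᵢ′→Z)

    z-by-A₁ : Determines h (E (A (# 1))) z
    z-by-A₁ = commonInformation-determinedˡ poly z-common

    z-by-A₂ : Determines h (E (A (# 2))) z
    z-by-A₂ = commonInformation-determinedʳ poly z-common

    w-by-A₀ : Determines h (E (A (# 0))) w
    w-by-A₀ = commonInformation-determinedˡ poly w-common

    w-by-A₁ : Determines h (E (A (# 1))) w
    w-by-A₁ = commonInformation-determinedʳ poly w-common

    z-by-column : ∀ j → Determines h (E (B j)) z
    z-by-column j@zero =
      determined-by-column (# 1) (# 2) j z-by-A₁ z-by-A₂ (mutual-rank _ _ 0 ≡.refl)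
    z-by-column j@(suc zero) =
      determined-by-column (# 1) (# 2) j z-by-A₁ z-by-A₂ (mutual-rank _ _ 0 ≡.refl)
    z-by-column j@(suc (suc zero)) =
      determined-by-column (# 1) (# 2) j z-by-A₁ z-by-A₂ (mutual-rank _ _ 0 ≡.refl)

    w-by-column : ∀ j → Determines h (E (B (suc j))) w
    w-by-column j@zero =
      determined-by-column (# 0) (# 1) (suc j) w-by-A₀ w-by-A₁ (mutual-rank _ _ 0 ≡.refl)
    w-by-column j@(suc zero) =
      determined-by-column (# 0) (# 1) (suc j) w-by-A₀ w-by-A₁ (mutual-rank _ _ 0 ≡.refl)

    wz-by-column : ∀ j → Determines h (E (B (suc j))) (w ∪ z)
    wz-by-column j = determines-∪ poly (w-by-column j) (z-by-column (suc j))

    -- Set expressions over the concrete subsets are compared by evaluation: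
    -- E (A 1) ∩ E (A 2) computes to ⊥, ⊥ ∪ w to w, and so on.
    common-informations-incompatible : Empty.⊥
    common-informations-incompatible = 1≰0 (begin
      1#
        ≈⟨ one-bit (A (# 1)) (A (# 2)) ≡.refl ⟨
      h [ E (A (# 1)) ∶ E (A (# 2)) ]
        ≤⟨ mutual≤common poly z-common ⟩
      h [ z ∣ ⊥ ]
        ≤⟨ cond-∩-modular poly {Z = z} (z-by-column (# 1))
                                       (mutual-rank (A (# 0) ∩ B (# 0)) (B (# 1)) 0 ≡.refl) ⟩
      h [ z ∣ E (A (# 0) ∩ B (# 0)) ]
        ≤⟨ cond-∩-modular poly {Z = z} (z-by-column (# 0))
                                       (mutual-rank (A (# 0)) (B (# 0)) 0 ≡.refl) ⟩
      h [ z ∣ E (A (# 0)) ]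
        ≤⟨ cond-antitone poly w-by-A₀ ⟩
      h [ z ∣ w ]
        ≈⟨ cond-chain poly ⊥ w z ⟩
      h [ w ∪ z ∣ ⊥ ] - h [ w ∣ ⊥ ]
        ≤⟨ x≤y∧v≤u⇒x-u≤y-v (cond-∩≤mutual poly (wz-by-column (# 0)) (wz-by-column (# 1)))
                            (mutual≤common poly w-common) ⟩
      h [ E (B (# 1)) ∶ E (B (# 2)) ] - h [ E (A (# 0)) ∶ E (A (# 1)) ]
        ≈⟨ +-cong (one-bit (B (# 1)) (B (# 2)) ≡.refl)
                  (-‿cong (one-bit (A (# 0)) (A (# 1)) ≡.refl)) ⟩
      1# - 1#
        ≈⟨ -‿inverseʳ 1# ⟩
      0#
        ∎)

  tictactoe-not-2-CI : ¬ IsKCI 2 9 (tictactoe R)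
  tictactoe-not-2-CI two-CI with two-CI (A (# 1)) (A (# 2))
  ... | m , g₁ , (_ , g₁-extends) , z-common₁ , one-CI
        with one-CI (lift m (A (# 0))) (lift m (A (# 1)))
  ... | m′ , g₂ , (g₂-poly , g₂-extends) , w-common₂ , _ =
    common-informations-incompatible (polymatroid-∘ φ-hom g₂-poly) rank z-common w-common
    where
    φ : Subset 11 → Subset ((9 ℕ.+ m) ℕ.+ m′)
    φ = attach m′ ∘ keepHead (attach m)

    φ-hom : IsSubsetHom φ
    φ-hom = ∘-isSubsetHom (attach-isSubsetHom m′) (keepHead-isSubsetHom (attach-isSubsetHom m))

    rank : ∀ X → g₂ (φ (E X)) ≈ tictactoe R X
    rank X = trans (g₂-extends (lift m X)) (g₁-extends X)

    -- z is a common information in g₁, which g₂ extends; this type unfolds to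
    -- IsCommonInformation (g₂ ∘ φ) z (E (A 1)) (E (A 2)).
    z-common : IsCommonInformation (λ Y → g₂ (φ (outside ∷ Y)))
                 (inside ∷ ⊥) (outside ∷ A (# 1)) (outside ∷ A (# 2))
    z-common = commonInformation-resp (λ Y → sym (g₂-extends (attach m Y)))
      (commonInformation-∘ (attach-isSubsetHom m) {g₁}
        (inside ∷ ⊥) (outside ∷ A (# 1)) (outside ∷ A (# 2)) z-common₁)

    w-common : IsCommonInformation (g₂ ∘ φ) w (E (A (# 0))) (E (A (# 1)))
    w-common = commonInformation-∘ φ-hom {g₂} w (E (A (# 0))) (E (A (# 1))) w-common₂

mainTheorem6 : ∀ {c ℓ₁ ℓ₂} (R : OrderedCommRing c ℓ₁ ℓ₂) →
    ¬ Poly.HasCIProperty R 9 (tictactoe R)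
mainTheorem6 R has-CI = TicTacToe.tictactoe-not-2-CI R (has-CI 2)
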